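{- Let $G$ be a nontrivial uniquely $C_4^{+}$-saturated graph with girth $3$, and let $S$ be the vertex set of a triangle in $G$. If $N^{2}(S)=\emptyset$, then $G$ is isomorphic to $C_3^{*}$.
   Context: All graphs are finite, simple and undirected. $C_4^{+}$ (the diamond) is the graph obtained from a $4$-cycle by adding one chord, i.e. $K_4$ minus an edge. $C_3^{*}$ is the graph consisting of a triangle with one pendant edge attached (4 vertices, 4 edges). For a graph $H$, a graph $G$ is uniquely $H$-saturated if $G$ contains no subgraph isomorphic to $H$, but for every pair of non-adjacent vertices $u,v$ of $G$, the graph $G+uv$ contains exactly one subgraph isomorphic to $H$. A uniquely $H$-saturated graph is nontrivial if it has at least $|V(H)|$ vertices. The girth is the minimum length of a cycle. For $U\subseteq V(G)$, $d(v,U)=\min\{d(v,u):u\in U\}$ and $N^{2}(U)=\{v\in V(G): d(v,U)=2\}$. -}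

module Defs where

open import Data.Nat using (ℕ; zero; suc; _<_; _≤_)
open import Data.Fin using (Fin; zero; suc; inject₁; fromℕ)
open import Data.Fin.Properties using (_≟_)
open import Data.Bool using (Bool; true; false; _∨_; _∧_)
open import Data.Product using (Σ; ∃; _×_; _,_)
open import Data.Sum using (_⊎_)
open import Relation.Nullary using (¬_)
open import Relation.Nullary.Decidable using (⌊_⌋)
open import Relation.Binary.PropositionalEquality using (_≡_; _≢_; refl)
open import Data.Empty using (⊥)
open import Function.Definitions using (Injective; Surjective)

record Graph (n : ℕ) : Set where
  field
    adj    : Fin n → Fin n → Bool
    sym    : ∀ x y → adj x y ≡ adj y x
    irrefl : ∀ x → adj x x ≡ false
open Graph public

Adj : ℕ → Set
Adj n = Fin n → Fin n → Bool

addEdge : ∀ {n} → Adj n → Fin n → Fin n → Adj n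
addEdge A u v x y =
  A x y ∨ ((⌊ x ≟ u ⌋ ∧ ⌊ y ≟ v ⌋) ∨ (⌊ x ≟ v ⌋ ∧ ⌊ y ≟ u ⌋))

-- An embedding of H (on Fin m) into a graph with adjacency A (on Fin n):
-- an injective vertex map sending edges to edges.  Its image is a
-- subgraph of the host isomorphic to H.
record Embedding {m n : ℕ} (H : Graph m) (A : Adj n) : Set where
  field
    map  : Fin m → Fin n
    inj  : Injective _≡_ _≡_ map
    hom  : ∀ a b → adj H a b ≡ true → A (map a) (map b) ≡ true
open Embedding public

ImgVertex : ∀ {m n} {H : Graph m} {A : Adj n} → Embedding H A → Fin n → Set
ImgVertex e x = ∃ λ a → map e a ≡ x

ImgEdge : ∀ {m n} {H : Graph m} {A : Adj n} → Embedding H A → Fin n → Fin n → Set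
ImgEdge {H = H} e x y =
  Σ _ λ a → Σ _ λ b → (adj H a b ≡ true) × (map e a ≡ x) × (map e b ≡ y)

SameSubgraph : ∀ {m n} {H : Graph m} {A : Adj n} → Embedding H A → Embedding H A → Set
SameSubgraph e f =
  (∀ x → (ImgVertex e x → ImgVertex f x) × (ImgVertex f x → ImgVertex e x)) ×
  (∀ x y → (ImgEdge e x y → ImgEdge f x y) × (ImgEdge f x y → ImgEdge e x y))

ContainsCopy : ∀ {m n} → Graph m → Adj n → Set
ContainsCopy H A = Embedding H A

ExactlyOneCopy : ∀ {m n} → Graph m → Adj n → Set
ExactlyOneCopy H A = Embedding H A × (∀ (e f : Embedding H A) → SameSubgraph e f)

UniquelySaturated : ∀ {m n} → Graph m → Graph n → Set
UniquelySaturated H G =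
  ¬ ContainsCopy H (adj G) ×
  (∀ u v → u ≢ v → adj G u v ≡ false → ExactlyOneCopy H (addEdge (adj G) u v))

Nontrivial : ∀ {m n} → Graph m → Graph n → Set
Nontrivial {m} {n} H G = m ≤ n

Walk : ∀ {n} → Graph n → (k : ℕ) → (Fin (suc k) → Fin n) → Set
Walk G k w = ∀ (i : Fin k) → Edge G (w (inject₁ i)) (w (suc i))
  where
  Edge : ∀ {n} → Graph n → Fin n → Fin n → Set
  Edge G x y = adj G x y ≡ true

-- a cycle of length suc j (needs suc j ≥ 3): distinct vertices c 0 … c j,
-- consecutive ones adjacent and c j adjacent to c 0
IsCycle : ∀ {n} → Graph n → (j : ℕ) → (Fin (suc j) → Fin n) → Set
IsCycle G j c =
  (3 ≤ suc j) × Injective _≡_ _≡_ c × Walk G j c × (adj G (c (fromℕ j)) (c zero) ≡ true)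

HasCycleOfLength : ∀ {n} → Graph n → ℕ → Set
HasCycleOfLength G zero = ⊥
HasCycleOfLength G (suc j) = Σ (Fin (suc j) → _) λ c → IsCycle G j c

Girth : ∀ {n} → Graph n → ℕ → Set
Girth G g = HasCycleOfLength G g × (∀ k → k < g → ¬ HasCycleOfLength G k)

WalkBetween : ∀ {n} → Graph n → Fin n → Fin n → ℕ → Set
WalkBetween G x y k = Σ (Fin (suc k) → _) λ w → Walk G k w × (w zero ≡ x) × (w (fromℕ k) ≡ y)

Dist : ∀ {n} → Graph n → Fin n → Fin n → ℕ → Set
Dist G x y k = WalkBetween G x y k × (∀ l → l < k → ¬ WalkBetween G x y l)

DistToSet : ∀ {n} → Graph n → Fin n → (Fin n → Set) → ℕ → Set
DistToSet G v U k =
  (∃ λ u → U u × Dist G v u k) × (∀ u → U u → ∀ l → Dist G v u l → k ≤ l)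

N2Empty : ∀ {n} → Graph n → (Fin n → Set) → Set
N2Empty G U = ∀ v → ¬ DistToSet G v U 2

TriangleSet : ∀ {n} → Fin n → Fin n → Fin n → Fin n → Set
TriangleSet a b c x = (x ≡ a) ⊎ (x ≡ b) ⊎ (x ≡ c)

IsTriangle : ∀ {n} → Graph n → Fin n → Fin n → Fin n → Set
IsTriangle G a b c = (adj G a b ≡ true) × (adj G b c ≡ true) × (adj G a c ≡ true)

Isomorphic : ∀ {m n} → Graph m → Graph n → Set
Isomorphic {m} {n} H G = Σ (Fin m → Fin n) λ f →
  Injective _≡_ _≡_ f × Surjective _≡_ _≡_ f × (∀ a b → adj G (f a) (f b) ≡ adj H a b)

-- the diamond C4⁺ = K4 minus the edge {2,3}
diamondAdj : Fin 4 → Fin 4 → Bool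
diamondAdj zero zero = false
diamondAdj zero _ = true
diamondAdj (suc zero) (suc zero) = false
diamondAdj (suc zero) _ = true
diamondAdj (suc (suc zero)) zero = true
diamondAdj (suc (suc zero)) (suc zero) = true
diamondAdj (suc (suc zero)) _ = false
diamondAdj (suc (suc (suc zero))) zero = true
diamondAdj (suc (suc (suc zero))) (suc zero) = true
diamondAdj (suc (suc (suc zero))) _ = false

C4⁺ : Graph 4
C4⁺ = record { adj = diamondAdj ; sym = s ; irrefl = r }
  where
  s : ∀ x y → diamondAdj x y ≡ diamondAdj y x
  s zero zero = refl
  s zero (suc zero) = refl
  s zero (suc (suc zero)) = refl
  s zero (suc (suc (suc zero))) = refl
  s (suc zero) zero = refl
  s (suc zero) (suc zero) = refl
  s (suc zero) (suc (suc zero)) = refl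
  s (suc zero) (suc (suc (suc zero))) = refl
  s (suc (suc zero)) zero = refl
  s (suc (suc zero)) (suc zero) = refl
  s (suc (suc zero)) (suc (suc zero)) = refl
  s (suc (suc zero)) (suc (suc (suc zero))) = refl
  s (suc (suc (suc zero))) zero = refl
  s (suc (suc (suc zero))) (suc zero) = refl
  s (suc (suc (suc zero))) (suc (suc zero)) = refl
  s (suc (suc (suc zero))) (suc (suc (suc zero))) = refl
  r : ∀ x → diamondAdj x x ≡ false
  r zero = refl
  r (suc zero) = refl
  r (suc (suc zero)) = refl
  r (suc (suc (suc zero))) = refl

-- C3* : triangle {0,1,2} with pendant edge {2,3}
pawAdj : Fin 4 → Fin 4 → Bool
pawAdj zero (suc zero) = true
pawAdj zero (suc (suc zero)) = true
pawAdj (suc zero) zero = true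
pawAdj (suc zero) (suc (suc zero)) = true
pawAdj (suc (suc zero)) zero = true
pawAdj (suc (suc zero)) (suc zero) = true
pawAdj (suc (suc zero)) (suc (suc (suc zero))) = true
pawAdj (suc (suc (suc zero))) (suc (suc zero)) = true
pawAdj _ _ = false

C3* : Graph 4
C3* = record { adj = pawAdj ; sym = s ; irrefl = r }
  where
  s : ∀ x y → pawAdj x y ≡ pawAdj y x
  s zero zero = refl
  s zero (suc zero) = refl
  s zero (suc (suc zero)) = refl
  s zero (suc (suc (suc zero))) = refl
  s (suc zero) zero = refl
  s (suc zero) (suc zero) = refl
  s (suc zero) (suc (suc zero)) = refl
  s (suc zero) (suc (suc (suc zero))) = refl
  s (suc (suc zero)) zero = refl
  s (suc (suc zero)) (suc zero) = refl
  s (suc (suc zero)) (suc (suc zero)) = refl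
  s (suc (suc zero)) (suc (suc (suc zero))) = refl
  s (suc (suc (suc zero))) zero = refl
  s (suc (suc (suc zero))) (suc zero) = refl
  s (suc (suc (suc zero))) (suc (suc zero)) = refl
  s (suc (suc (suc zero))) (suc (suc (suc zero))) = refl
  r : ∀ x → pawAdj x x ≡ false
  r zero = refl
  r (suc zero) = refl
  r (suc (suc zero)) = refl
  r (suc (suc (suc zero))) = refl

{-# OPTIONS --safe #-}
-- Every vertex x outside the triangle S = {a, b, c} is adjacent to S: otherwise the
-- diamond of G + xa contains a common neighbour of x and a, which puts x in N²(S).
-- Such an x has no other neighbour: a second neighbour in S closes a diamond in G, and
-- a neighbour z outside S (itself adjacent to S) makes G + xb contain two diamonds on
-- different vertex sets.  Two distinct such pendant vertices x, y are non-adjacent, yet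
-- the diamond of G + xy needs a common neighbour of x and y and a further neighbour of
-- one of them.  So, having at least four vertices, G is the triangle with one pendant edge.
module Submission where

open import Defs hiding (sym)
open import Data.Nat using (ℕ; zero; suc; _<_; _≤_; s≤s)
open import Data.Nat.Properties using (≮⇒≥; n<1+n)
open import Data.Fin using (Fin; zero; suc; inject≤)
open import Data.Fin.Properties using (_≟_; all?; any?; ¬∀⟶∃¬; inject≤-injective; <⇒notInjective)
open import Data.Bool using (true; false; _∨_; _∧_)
open import Data.Bool.Properties using (∨-comm; ∧-comm; ∨-zeroʳ; ¬-not) renaming (_≟_ to _≟ᵇ_)
open import Function.Definitions using (Injective; Surjective)
open import Data.Product using (_×_; _,_; ∃; ∃₂; proj₁; proj₂)
open import Data.Sum using (_⊎_; inj₁; inj₂; [_,_]′)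
import Data.Sum as Sum
open import Function using (_∘_)
open import Relation.Nullary using (¬_; Dec; yes; no; ¬?)
open import Relation.Nullary.Decidable using (⌊_⌋; _→-dec_; _×-dec_; _⊎-dec_; toWitness)
open import Data.Empty using (⊥-elim)
open import Relation.Binary.PropositionalEquality using (_≡_; _≢_; refl; sym; trans; cong; cong₂; subst₂; ≢-sym)

private variable
  n : ℕ

Edge : Graph n → Fin n → Fin n → Set
Edge G x y = adj G x y ≡ true

edge-sym : (G : Graph n) {x y : Fin n} → Edge G x y → Edge G y x
edge-sym G {x} {y} e = trans (Graph.sym G y x) e

edge⇒≢ : (G : Graph n) {x y : Fin n} → Edge G x y → x ≢ y
edge⇒≢ G {x} e refl with trans (sym e) (Graph.irrefl G x)
... | ()

addEdge-cases : (A : Adj n) (u v x y : Fin n) → addEdge A u v x y ≡ true →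
  A x y ≡ true ⊎ (x ≡ u × y ≡ v) ⊎ (x ≡ v × y ≡ u)
addEdge-cases A u v x y e with A x y | x ≟ u | y ≟ v | x ≟ v | y ≟ u
... | true  | _      | _      | _      | _      = inj₁ refl
... | false | yes xu | yes yv | _      | _      = inj₂ (inj₁ (xu , yv))
... | false | _      | _      | yes xv | yes yu = inj₂ (inj₂ (xv , yu))
addEdge-cases A u v x y () | false | no _  | _    | no _  | _
addEdge-cases A u v x y () | false | no _  | _    | yes _ | no _
addEdge-cases A u v x y () | false | yes _ | no _ | no _  | _
addEdge-cases A u v x y () | false | yes _ | no _ | yes _ | no _

addEdge-sym : (G : Graph n) (u v x y : Fin n) →
  addEdge (adj G) u v x y ≡ addEdge (adj G) u v y x
addEdge-sym G u v x y = cong₂ _∨_ (Graph.sym G x y)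
  (trans (∨-comm (⌊ x ≟ u ⌋ ∧ ⌊ y ≟ v ⌋) _)
         (cong₂ _∨_ (∧-comm ⌊ x ≟ v ⌋ _) (∧-comm ⌊ x ≟ u ⌋ _)))

addEdge-irrefl : (G : Graph n) {u v : Fin n} → u ≢ v → ∀ x → addEdge (adj G) u v x x ≡ false
addEdge-irrefl G {u} {v} u≢v x rewrite Graph.irrefl G x with x ≟ u | x ≟ v
... | yes refl | yes refl = ⊥-elim (u≢v refl)
... | yes _    | no _     = refl
... | no _     | yes _    = refl
... | no _     | no _     = refl

withEdge : (G : Graph n) {u v : Fin n} → u ≢ v → Graph n
withEdge G {u} {v} u≢v = record
  { adj = addEdge (adj G) u v ; sym = addEdge-sym G u v ; irrefl = addEdge-irrefl G u≢v }

module _ (G : Graph n) {u v : Fin n} (u≢v : u ≢ v) where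

  withEdge-old : {x y : Fin n} → Edge G x y → Edge (withEdge G u≢v) x y
  withEdge-old e rewrite e = refl

  withEdge-new : Edge (withEdge G u≢v) u v
  withEdge-new with u ≟ u | v ≟ v
  ... | yes _ | yes _ = ∨-zeroʳ (adj G u v)
  ... | no u≢u | _ = ⊥-elim (u≢u refl)
  ... | _ | no v≢v = ⊥-elim (v≢v refl)

  withEdge-away : {x y : Fin n} → Edge (withEdge G u≢v) x y → y ≢ u → y ≢ v → Edge G x y
  withEdge-away {x} {y} e y≢u y≢v with addEdge-cases (adj G) u v x y e
  ... | inj₁ old = old
  ... | inj₂ (inj₁ (_ , y≡v)) = ⊥-elim (y≢v y≡v)
  ... | inj₂ (inj₂ (_ , y≡u)) = ⊥-elim (y≢u y≡u)

quad : {A : Set} → A → A → A → A → Fin 4 → A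
quad p q r s zero = p
quad p q r s (suc zero) = q
quad p q r s (suc (suc zero)) = r
quad p q r s (suc (suc (suc zero))) = s

quad-injective : {A : Set} {p q r s : A} → p ≢ q → p ≢ r → p ≢ s → q ≢ r → q ≢ s → r ≢ s →
  Injective _≡_ _≡_ (quad p q r s)
quad-injective p≢q p≢r p≢s q≢r q≢s r≢s {i} {j} = go i j
  where
  go : ∀ i j → quad _ _ _ _ i ≡ quad _ _ _ _ j → i ≡ j
  go zero zero _ = refl
  go zero (suc zero) e = ⊥-elim (p≢q e)
  go zero (suc (suc zero)) e = ⊥-elim (p≢r e)
  go zero (suc (suc (suc zero))) e = ⊥-elim (p≢s e)
  go (suc zero) zero e = ⊥-elim (p≢q (sym e))
  go (suc zero) (suc zero) _ = refl
  go (suc zero) (suc (suc zero)) e = ⊥-elim (q≢r e)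
  go (suc zero) (suc (suc (suc zero))) e = ⊥-elim (q≢s e)
  go (suc (suc zero)) zero e = ⊥-elim (p≢r (sym e))
  go (suc (suc zero)) (suc zero) e = ⊥-elim (q≢r (sym e))
  go (suc (suc zero)) (suc (suc zero)) _ = refl
  go (suc (suc zero)) (suc (suc (suc zero))) e = ⊥-elim (r≢s e)
  go (suc (suc (suc zero))) zero e = ⊥-elim (p≢s (sym e))
  go (suc (suc (suc zero))) (suc zero) e = ⊥-elim (q≢s (sym e))
  go (suc (suc (suc zero))) (suc (suc zero)) e = ⊥-elim (r≢s (sym e))
  go (suc (suc (suc zero))) (suc (suc (suc zero))) _ = refl

quad-image : {A : Set} {p q r s y : A} (i : Fin 4) → quad p q r s i ≡ y →
  y ≡ p ⊎ y ≡ q ⊎ y ≡ r ⊎ y ≡ s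
quad-image zero e = inj₁ (sym e)
quad-image (suc zero) e = inj₂ (inj₁ (sym e))
quad-image (suc (suc zero)) e = inj₂ (inj₂ (inj₁ (sym e)))
quad-image (suc (suc (suc zero))) e = inj₂ (inj₂ (inj₂ (sym e)))

diamond : (H : Graph n) {p q r s : Fin n} →
  Edge H p q → Edge H p r → Edge H q r → Edge H p s → Edge H q s → r ≢ s →
  Embedding C4⁺ (adj H)
diamond H {p} {q} {r} {s} pq pr qr ps qs r≢s = record
  { map = quad p q r s
  ; inj = quad-injective (edge⇒≢ H pq) (edge⇒≢ H pr) (edge⇒≢ H ps) (edge⇒≢ H qr) (edge⇒≢ H qs) r≢s
  ; hom = edges }
  where
  edges : ∀ i j → diamondAdj i j ≡ true → Edge H (quad p q r s i) (quad p q r s j)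
  edges zero (suc zero) _ = pq
  edges zero (suc (suc zero)) _ = pr
  edges zero (suc (suc (suc zero))) _ = ps
  edges (suc zero) zero _ = edge-sym H pq
  edges (suc zero) (suc (suc zero)) _ = qr
  edges (suc zero) (suc (suc (suc zero))) _ = qs
  edges (suc (suc zero)) zero _ = edge-sym H pr
  edges (suc (suc zero)) (suc zero) _ = edge-sym H qr
  edges (suc (suc (suc zero))) zero _ = edge-sym H ps
  edges (suc (suc (suc zero))) (suc zero) _ = edge-sym H qs
  edges zero zero ()
  edges (suc zero) (suc zero) ()
  edges (suc (suc zero)) (suc (suc zero)) ()
  edges (suc (suc zero)) (suc (suc (suc zero))) ()
  edges (suc (suc (suc zero))) (suc (suc zero)) ()
  edges (suc (suc (suc zero))) (suc (suc (suc zero))) ()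

module _ {k : ℕ} (H : Graph k) (G : Graph n) {u v : Fin n} (u≢v : u ≢ v) where

  private
    preserved? : (e : Embedding H (adj (withEdge G u≢v))) (i j : Fin k) →
      Dec (Edge H i j → Edge G (map e i) (map e j))
    preserved? e i j = (adj H i j ≟ᵇ true) →-dec (adj G (map e i) (map e j) ≟ᵇ true)

  copy-uses-new-edge : ¬ Embedding H (adj G) → (e : Embedding H (adj (withEdge G u≢v))) →
    ∃₂ λ i j → Edge H i j × map e i ≡ u × map e j ≡ v
  copy-uses-new-edge free e with all? (λ i → all? (preserved? e i))
  ... | yes pres = ⊥-elim (free (record { map = map e ; inj = inj e ; hom = pres }))
  ... | no ¬pres with ¬∀⟶∃¬ _ _ (λ i → all? (preserved? e i)) ¬pres
  ... | i , ¬pres-i with ¬∀⟶∃¬ _ _ (preserved? e i) ¬pres-i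
  ... | j , ¬pres-ij with adj H i j ≟ᵇ true
  ...   | no ¬ij = ⊥-elim (¬pres-ij (λ ij → ⊥-elim (¬ij ij)))
  ...   | yes ij with addEdge-cases (adj G) u v _ _ (hom e i j ij)
  ...     | inj₁ old = ⊥-elim (¬pres-ij (λ _ → old))
  ...     | inj₂ (inj₁ (iu , jv)) = i , j , ij , iu , jv
  ...     | inj₂ (inj₂ (iv , ju)) = j , i , edge-sym H ij , ju , iv

-- What a diamond through the edge uv leaves behind once uv is deleted.
record OpenDiamond (G : Graph n) (u v : Fin n) : Set where
  field
    common spare : Fin n
    u-common : Edge G u common
    v-common : Edge G v common
    u-spare⊎v-spare : Edge G u spare ⊎ Edge G v spare
    spare≢u : spare ≢ u
    spare≢v : spare ≢ v
    common≢spare : common ≢ spare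

OpenDiamond-map : {k : ℕ} {H : Graph k} {G : Graph n} (e : Embedding H (adj G)) {i j : Fin k} →
  OpenDiamond H i j → OpenDiamond G (map e i) (map e j)
OpenDiamond-map e {i} {j} o = record
  { common = map e common
  ; spare = map e spare
  ; u-common = hom e i common u-common
  ; v-common = hom e j common v-common
  ; u-spare⊎v-spare = Sum.map (hom e i spare) (hom e j spare) u-spare⊎v-spare
  ; spare≢u = spare≢u ∘ inj e
  ; spare≢v = spare≢v ∘ inj e
  ; common≢spare = common≢spare ∘ inj e }
  where open OpenDiamond o

OpenDiamond-dropEdge : (G : Graph n) {u v : Fin n} (u≢v : u ≢ v) →
  OpenDiamond (withEdge G u≢v) u v → OpenDiamond G u v
OpenDiamond-dropEdge {n} G {u} {v} u≢v o = record
  { common = common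
  ; spare = spare
  ; u-common = old u-common common≢u common≢v
  ; v-common = old v-common common≢u common≢v
  ; u-spare⊎v-spare = Sum.map old-spare old-spare u-spare⊎v-spare
  ; spare≢u = spare≢u
  ; spare≢v = spare≢v
  ; common≢spare = common≢spare }
  where
  open OpenDiamond o
  old : {x y : Fin n} → Edge (withEdge G u≢v) x y → y ≢ u → y ≢ v → Edge G x y
  old = withEdge-away G u≢v
  common≢u : common ≢ u
  common≢u = ≢-sym (edge⇒≢ (withEdge G u≢v) u-common)
  common≢v : common ≢ v
  common≢v = ≢-sym (edge⇒≢ (withEdge G u≢v) v-common)
  old-spare : {x : Fin n} → Edge (withEdge G u≢v) x spare → Edge G x spare
  old-spare e = old e spare≢u spare≢v

C4⁺-edge-OpenDiamond : (i j : Fin 4) → Edge C4⁺ i j → OpenDiamond C4⁺ i j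
C4⁺-edge-OpenDiamond i j ij with toWitness {a? = search} _ i j ij
  where
  edge? : ∀ i j → Dec (Edge C4⁺ i j)
  edge? i j = adj C4⁺ i j ≟ᵇ true
  search : Dec (∀ i j → Edge C4⁺ i j → ∃₂ λ k l →
    Edge C4⁺ i k × Edge C4⁺ j k × (Edge C4⁺ i l ⊎ Edge C4⁺ j l) × l ≢ i × l ≢ j × k ≢ l)
  search = all? λ i → all? λ j → edge? i j →-dec any? λ k → any? λ l →
    edge? i k ×-dec edge? j k ×-dec (edge? i l ⊎-dec edge? j l) ×-dec
    ¬? (l ≟ i) ×-dec ¬? (l ≟ j) ×-dec ¬? (k ≟ l)
... | k , l , ik , jk , il⊎jl , l≢i , l≢j , k≢l = record
  { common = k ; spare = l ; u-common = ik ; v-common = jk ; u-spare⊎v-spare = il⊎jl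
  ; spare≢u = l≢i ; spare≢v = l≢j ; common≢spare = k≢l }

diamond⇒OpenDiamond : (G : Graph n) {u v : Fin n} (u≢v : u ≢ v) → ¬ Embedding C4⁺ (adj G) →
  Embedding C4⁺ (adj (withEdge G u≢v)) → OpenDiamond G u v
diamond⇒OpenDiamond G u≢v free e with copy-uses-new-edge C4⁺ G u≢v free e
... | i , j , ij , iu , jv = OpenDiamond-dropEdge G u≢v
  (subst₂ (OpenDiamond (withEdge G u≢v)) iu jv (OpenDiamond-map e (C4⁺-edge-OpenDiamond i j ij)))

walk₂ : (G : Graph n) {x z y : Fin n} → Edge G x z → Edge G z y → WalkBetween G x y 2
walk₂ {n} G {x} {z} {y} xz zy = path , steps , refl , refl
  where
  path : Fin 3 → Fin n
  path zero = x
  path (suc zero) = z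
  path (suc (suc zero)) = y
  steps : Walk G 2 path
  steps zero = xz
  steps (suc zero) = zy

no-short-walk : (G : Graph n) {x y : Fin n} → x ≢ y → adj G x y ≡ false →
  ∀ l → l < 2 → ¬ WalkBetween G x y l
no-short-walk G x≢y _ 0 _ (_ , _ , refl , refl) = x≢y refl
no-short-walk G _ x≁y 1 _ (_ , step , refl , refl) with trans (sym (step zero)) x≁y
... | ()
no-short-walk G _ _ (suc (suc _)) (s≤s (s≤s ())) _

distToSet-two : (G : Graph n) {U : Fin n → Set} {x z a : Fin n} →
  (∀ u → U u → x ≢ u × adj G x u ≡ false) → U a → Edge G x z → Edge G z a → DistToSet G x U 2
distToSet-two G far Ua xz za =
  (_ , Ua , walk₂ G xz za , no-short-walk G (proj₁ (far _ Ua)) (proj₂ (far _ Ua))) ,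
  λ u Uu l (walk , _) → ≮⇒≥ λ l<2 → no-short-walk G (proj₁ (far u Uu)) (proj₂ (far u Uu)) l l<2 walk

Outside : Fin n → Fin n → Fin n → Fin n → Set
Outside a b c x = x ≢ a × x ≢ b × x ≢ c

∉⇒Outside : {a b c x : Fin n} → ¬ TriangleSet a b c x → Outside a b c x
∉⇒Outside x∉ = x∉ ∘ inj₁ , x∉ ∘ inj₂ ∘ inj₁ , x∉ ∘ inj₂ ∘ inj₂

triangleSet? : (a b c x : Fin n) → Dec (TriangleSet a b c x)
triangleSet? a b c x = (x ≟ a) ⊎-dec (x ≟ b) ⊎-dec (x ≟ c)

Outside⇒∉ : {a b c x t : Fin n} → Outside a b c x → TriangleSet a b c t → x ≢ t
Outside⇒∉ (x≢a , _ , _) (inj₁ refl) = x≢a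
Outside⇒∉ (_ , x≢b , _) (inj₂ (inj₁ refl)) = x≢b
Outside⇒∉ (_ , _ , x≢c) (inj₂ (inj₂ refl)) = x≢c

position : {a b c x : Fin n} → TriangleSet a b c x → Fin 3
position (inj₁ _) = zero
position (inj₂ (inj₁ _)) = suc zero
position (inj₂ (inj₂ _)) = suc (suc zero)

position-injective : {a b c x y : Fin n} (p : TriangleSet a b c x) (q : TriangleSet a b c y) →
  position p ≡ position q → x ≡ y
position-injective (inj₁ refl) (inj₁ refl) _ = refl
position-injective (inj₂ (inj₁ refl)) (inj₂ (inj₁ refl)) _ = refl
position-injective (inj₂ (inj₂ refl)) (inj₂ (inj₂ refl)) _ = refl
position-injective (inj₁ _) (inj₂ (inj₁ _)) ()
position-injective (inj₁ _) (inj₂ (inj₂ _)) ()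
position-injective (inj₂ (inj₁ _)) (inj₁ _) ()
position-injective (inj₂ (inj₁ _)) (inj₂ (inj₂ _)) ()
position-injective (inj₂ (inj₂ _)) (inj₁ _) ()
position-injective (inj₂ (inj₂ _)) (inj₂ (inj₁ _)) ()

fourth-vertex : 4 ≤ n → (a b c : Fin n) → ∃ (Outside a b c)
fourth-vertex 4≤n a b c with all? (λ i → triangleSet? a b c (inject≤ i 4≤n))
... | yes member = ⊥-elim (<⇒notInjective (n<1+n 3) positions-injective)
  where
  positions-injective : Injective _≡_ _≡_ (λ i → position (member i))
  positions-injective {i} {j} =
    inject≤-injective 4≤n 4≤n i j ∘ position-injective (member i) (member j)
... | no ¬member with ¬∀⟶∃¬ _ _ (λ i → triangleSet? a b c (inject≤ i 4≤n)) ¬member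
... | i , i∉ = inject≤ i 4≤n , ∉⇒Outside i∉

IsTriangle-swap₁₂ : (G : Graph n) {a b c : Fin n} → IsTriangle G a b c → IsTriangle G b a c
IsTriangle-swap₁₂ G (ab , bc , ac) = edge-sym G ab , ac , bc

IsTriangle-swap₂₃ : (G : Graph n) {a b c : Fin n} → IsTriangle G a b c → IsTriangle G a c b
IsTriangle-swap₂₃ G (ab , bc , ac) = ac , edge-sym G bc , ab

Outside-swap₁₂ : {a b c x : Fin n} → Outside a b c x → Outside b a c x
Outside-swap₁₂ (x≢a , x≢b , x≢c) = x≢b , x≢a , x≢c

Outside-swap₂₃ : {a b c x : Fin n} → Outside a b c x → Outside a c b x
Outside-swap₂₃ (x≢a , x≢b , x≢c) = x≢a , x≢c , x≢b

Pendant : Graph n → Fin n → Fin n → Set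
Pendant G x t = ∀ z → Edge G x z → z ≡ t

Attached : Graph n → Fin n → Fin n → Fin n → Fin n → Set
Attached G a b c x = Edge G x a ⊎ Edge G x b ⊎ Edge G x c

AllAttached : Graph n → Fin n → Fin n → Fin n → Set
AllAttached G a b c = ∀ x → Outside a b c x → Attached G a b c x

AllAttached-swap₁₂ : (G : Graph n) {a b c : Fin n} → AllAttached G a b c → AllAttached G b a c
AllAttached-swap₁₂ G att x = Sum.assocʳ ∘ Sum.map₁ Sum.swap ∘ Sum.assocˡ ∘ att x ∘ Outside-swap₁₂

AllAttached-swap₂₃ : (G : Graph n) {a b c : Fin n} → AllAttached G a b c → AllAttached G a c b
AllAttached-swap₂₃ G att x = Sum.map₂ Sum.swap ∘ att x ∘ Outside-swap₂₃

module UniquelyDiamondSaturated (G : Graph n) (sat : UniquelySaturated C4⁺ G) where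

  diamond-free : ¬ Embedding C4⁺ (adj G)
  diamond-free = proj₁ sat

  module _ {u v : Fin n} (u≢v : u ≢ v) (u≁v : adj G u v ≡ false) where

    open-diamond : OpenDiamond G u v
    open-diamond = diamond⇒OpenDiamond G u≢v diamond-free (proj₁ (proj₂ sat u v u≢v u≁v))

    same-vertices : (D E : Embedding C4⁺ (adj (withEdge G u≢v))) {y : Fin n} →
      ImgVertex D y → ImgVertex E y
    same-vertices D E = proj₁ (proj₁ (proj₂ (proj₂ sat u v u≢v u≁v) D E) _)

  N2Empty⇒AllAttached : {a b c : Fin n} → N2Empty G (TriangleSet a b c) → AllAttached G a b c
  N2Empty⇒AllAttached {a} {b} {c} n2 x (x≢a , x≢b , x≢c)
    with adj G x a in xa | adj G x b in xb | adj G x c in xc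
  ... | true  | _     | _     = inj₁ refl
  ... | false | true  | _     = inj₂ (inj₁ refl)
  ... | false | false | true  = inj₂ (inj₂ refl)
  ... | false | false | false =
    ⊥-elim (n2 x (distToSet-two G far (inj₁ refl) u-common (edge-sym G v-common)))
    where
    open OpenDiamond (open-diamond x≢a xa)
    far : ∀ t → TriangleSet a b c t → x ≢ t × adj G x t ≡ false
    far t (inj₁ refl) = x≢a , xa
    far t (inj₂ (inj₁ refl)) = x≢b , xb
    far t (inj₂ (inj₂ refl)) = x≢c , xc

  no-apex : {a b c x : Fin n} → IsTriangle G a b c → x ≢ c → Edge G x a → ¬ Edge G x b
  no-apex (ab , bc , ac) x≢c xa xb =
    diamond-free (diamond G ab (edge-sym G xa) (edge-sym G xb) ac bc x≢c)

  -- G + xb contains the diamond on {a, b, x, c} and one on {x, a, b, z}, and only the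
  -- first contains c.
  outside-neighbour-detached : {a b c x z : Fin n} → IsTriangle G a b c → Outside a b c x →
    Edge G x a → Outside a b c z → Edge G x z → ¬ (Edge G z a ⊎ Edge G z b)
  outside-neighbour-detached {a} {b} {c} {x} {z}
    (ab , bc , ac) (_ , x≢b , x≢c) xa (z≢a , z≢b , z≢c) xz z~ab =
    c-not-in-D₂ z~ab (same-vertices x≢b x≁b D₁ (D₂ z~ab) (suc (suc (suc zero)) , refl))
    where
    x≁b : adj G x b ≡ false
    x≁b = ¬-not (no-apex (ab , bc , ac) x≢c xa)
    G+xb : Graph n
    G+xb = withEdge G x≢b
    old : {y w : Fin n} → Edge G y w → Edge G+xb y w
    old = withEdge-old G x≢b
    xb : Edge G+xb x b
    xb = withEdge-new G x≢b
    c≢a : c ≢ a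
    c≢a = ≢-sym (edge⇒≢ G ac)
    c≢b : c ≢ b
    c≢b = ≢-sym (edge⇒≢ G bc)
    D₁ : Embedding C4⁺ (adj G+xb)
    D₁ = diamond G+xb (old ab) (old (edge-sym G xa)) (edge-sym G+xb xb) (old ac) (old bc) x≢c
    D₂ : Edge G z a ⊎ Edge G z b → Embedding C4⁺ (adj G+xb)
    D₂ (inj₁ za) = diamond G+xb (old xa) xb (old ab) (old xz) (old (edge-sym G za)) (≢-sym z≢b)
    D₂ (inj₂ zb) =
      diamond G+xb xb (old xa) (old (edge-sym G ab)) (old xz) (old (edge-sym G zb)) (≢-sym z≢a)
    c-not-in-D₂ : (z~ab : Edge G z a ⊎ Edge G z b) → ¬ ImgVertex (D₂ z~ab) c
    c-not-in-D₂ (inj₁ za) (i , e) = [ x≢c ∘ sym , [ c≢a , [ c≢b , z≢c ∘ sym ]′ ]′ ]′ (quad-image i e)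
    c-not-in-D₂ (inj₂ zb) (i , e) = [ x≢c ∘ sym , [ c≢b , [ c≢a , z≢c ∘ sym ]′ ]′ ]′ (quad-image i e)

  Edge⇒Pendant : {a b c x : Fin n} → IsTriangle G a b c → AllAttached G a b c →
    Outside a b c x → Edge G x a → Pendant G x a
  Edge⇒Pendant {a} {b} {c} T att x-out@(_ , x≢b , x≢c) xa z xz with z ≟ a | z ≟ b | z ≟ c
  ... | yes z≡a | _        | _        = z≡a
  ... | no _    | yes refl | _        = ⊥-elim (no-apex T x≢c xa xz)
  ... | no _    | no _     | yes refl = ⊥-elim (no-apex (IsTriangle-swap₂₃ G T) x≢b xa xz)
  ... | no z≢a  | no z≢b   | no z≢c   = ⊥-elim (detached (att z z-out))
    where
    z-out : Outside a b c z
    z-out = z≢a , z≢b , z≢c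
    detached : ¬ Attached G a b c z
    detached (inj₁ za) = outside-neighbour-detached T x-out xa z-out xz (inj₁ za)
    detached (inj₂ (inj₁ zb)) = outside-neighbour-detached T x-out xa z-out xz (inj₂ zb)
    detached (inj₂ (inj₂ zc)) = outside-neighbour-detached
      (IsTriangle-swap₂₃ G T) (Outside-swap₂₃ x-out) xa (Outside-swap₂₃ z-out) xz (inj₂ zc)

  Outside⇒Pendant : {a b c x : Fin n} → IsTriangle G a b c → AllAttached G a b c →
    Outside a b c x → ∃ λ t → TriangleSet a b c t × Edge G x t × Pendant G x t
  Outside⇒Pendant {a} {b} {c} T att x-out with att _ x-out
  ... | inj₁ xa = a , inj₁ refl , xa , Edge⇒Pendant T att x-out xa
  ... | inj₂ (inj₁ xb) = b , inj₂ (inj₁ refl) , xb ,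
    Edge⇒Pendant (IsTriangle-swap₁₂ G T) (AllAttached-swap₁₂ G att) (Outside-swap₁₂ x-out) xb
  ... | inj₂ (inj₂ xc) = c , inj₂ (inj₂ refl) , xc ,
    Edge⇒Pendant (IsTriangle-swap₁₂ G (IsTriangle-swap₂₃ G T))
            (AllAttached-swap₁₂ G (AllAttached-swap₂₃ G att))
            (Outside-swap₁₂ (Outside-swap₂₃ x-out)) xc

  outside-unique : {a b c x y : Fin n} → IsTriangle G a b c → AllAttached G a b c →
    Outside a b c x → Outside a b c y → x ≡ y
  -- A common neighbour of the pendant vertices x and y would be the only neighbour of each,
  -- leaving no room for the spare vertex of an open diamond at xy.
  outside-unique {x = x} {y} T att x-out y-out with x ≟ y
  ... | yes x≡y = x≡y
  ... | no x≢y with Outside⇒Pendant T att x-out | Outside⇒Pendant T att y-out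
  ...   | t , t∈S , _ , x-pendant | s , _ , _ , y-pendant = ⊥-elim (common≢spare common≡spare)
    where
    open OpenDiamond (open-diamond x≢y (¬-not (Outside⇒∉ y-out t∈S ∘ x-pendant _)))
    common≡spare : common ≡ spare
    common≡spare = [ (λ xw → trans (x-pendant _ u-common) (sym (x-pendant _ xw)))
                   , (λ yw → trans (y-pendant _ v-common) (sym (y-pendant _ yw))) ]′ u-spare⊎v-spare

  paw : {t p q x : Fin n} → IsTriangle G t p q → Outside t p q x → Edge G x t → Pendant G x t →
    (∀ y → Outside t p q y → y ≡ x) → Isomorphic C3* G
  paw {t} {p} {q} {x} (tp , pq , tq) (x≢t , x≢p , x≢q) xt x-pendant unique =
    f , quad-injective p≢q p≢t (≢-sym x≢p) q≢t (≢-sym x≢q) (≢-sym x≢t) , surjective , edges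
    where
    f : Fin 4 → Fin n
    f = quad p q t x
    p≢q : p ≢ q
    p≢q = edge⇒≢ G pq
    p≢t : p ≢ t
    p≢t = ≢-sym (edge⇒≢ G tp)
    q≢t : q ≢ t
    q≢t = ≢-sym (edge⇒≢ G tq)
    x≁ : ∀ {y} → y ≢ t → adj G x y ≡ false
    x≁ y≢t = ¬-not (y≢t ∘ x-pendant _)
    ≁x : ∀ {y} → y ≢ t → adj G y x ≡ false
    ≁x {y} y≢t = trans (Graph.sym G y x) (x≁ y≢t)
    preimage : ∀ k {y} → f k ≡ y → ∃ λ k → ∀ {z} → z ≡ k → f z ≡ y
    preimage k e = k , λ z≡k → trans (cong f z≡k) e
    surjective : Surjective _≡_ _≡_ f
    surjective y with triangleSet? t p q y
    ... | yes (inj₁ y≡t) = preimage (suc (suc zero)) (sym y≡t)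
    ... | yes (inj₂ (inj₁ y≡p)) = preimage zero (sym y≡p)
    ... | yes (inj₂ (inj₂ y≡q)) = preimage (suc zero) (sym y≡q)
    ... | no y∉ = preimage (suc (suc (suc zero))) (sym (unique y (∉⇒Outside y∉)))
    edges : ∀ i j → adj G (f i) (f j) ≡ pawAdj i j
    edges zero zero = Graph.irrefl G p
    edges zero (suc zero) = pq
    edges zero (suc (suc zero)) = edge-sym G tp
    edges zero (suc (suc (suc zero))) = ≁x p≢t
    edges (suc zero) zero = edge-sym G pq
    edges (suc zero) (suc zero) = Graph.irrefl G q
    edges (suc zero) (suc (suc zero)) = edge-sym G tq
    edges (suc zero) (suc (suc (suc zero))) = ≁x q≢t
    edges (suc (suc zero)) zero = tp
    edges (suc (suc zero)) (suc zero) = tq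
    edges (suc (suc zero)) (suc (suc zero)) = Graph.irrefl G t
    edges (suc (suc zero)) (suc (suc (suc zero))) = edge-sym G xt
    edges (suc (suc (suc zero))) zero = x≁ p≢t
    edges (suc (suc (suc zero))) (suc zero) = x≁ q≢t
    edges (suc (suc (suc zero))) (suc (suc zero)) = xt
    edges (suc (suc (suc zero))) (suc (suc (suc zero))) = Graph.irrefl G x

  AllAttached⇒paw : {a b c : Fin n} → 4 ≤ n → IsTriangle G a b c → AllAttached G a b c →
    Isomorphic C3* G
  AllAttached⇒paw {a} {b} {c} 4≤n T att with fourth-vertex 4≤n a b c
  ... | x , x-out with Outside⇒Pendant T att x-out
  ...   | _ , inj₁ refl , xt , x-pendant =
    paw T x-out xt x-pendant (λ y y-out → outside-unique T att y-out x-out)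
  ...   | _ , inj₂ (inj₁ refl) , xt , x-pendant =
    paw (IsTriangle-swap₁₂ G T) (Outside-swap₁₂ x-out) xt x-pendant
        (λ y y-out → outside-unique T att (Outside-swap₁₂ y-out) x-out)
  ...   | _ , inj₂ (inj₂ refl) , xt , x-pendant =
    paw (IsTriangle-swap₁₂ G (IsTriangle-swap₂₃ G T)) (Outside-swap₁₂ (Outside-swap₂₃ x-out))
        xt x-pendant (λ y y-out → outside-unique T att (Outside-swap₂₃ (Outside-swap₁₂ y-out)) x-out)

-- The girth hypothesis only guarantees that G has a triangle, and one is given.
theorem3p2 : ∀ {n : ℕ} (G : Graph n) →
    UniquelySaturated C4⁺ G → Nontrivial C4⁺ G → Girth G 3 →
    (a b c : Fin n) → IsTriangle G a b c →
    N2Empty G (TriangleSet a b c) →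
    Isomorphic C3* G
theorem3p2 G sat 4≤n _ a b c T n2 = AllAttached⇒paw 4≤n T (N2Empty⇒AllAttached n2)
  where open UniquelyDiamondSaturated G sat
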